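{- Let $m,t\geqslant1$ and $\ell\geqslant2$ be integers and let $r_1,\ldots,r_m$ be integers with $1\leqslant r_i<\ell$. For each $\vec e_0=(e_{0,1},\ldots,e_{0,m})\in\mathbb{Z}_{\geqslant0}^m$ with $1\leqslant|\vec e_0|\leqslant t$ there exist coefficients $c_{\vec e,\vec e_0}$, $\vec e\in\mathcal{E}(\vec e_0)$, such that $$\ell^{|\vec e_0|-1}y_1^{e_{0,1}}\cdots y_m^{e_{0,m}}=\sum_{\vec e\in\mathcal{E}(\vec e_0)}c_{\vec e,\vec e_0}f_{\vec e}(y_1,\ldots,y_m)$$ as polynomials, and $$c_{\vec e_0,\vec e_0}=1,\qquad c_{\vec e,\vec e_0}\ll r_1^{e_{0,1}-e_1}\cdots r_m^{e_{0,m}-e_m}\quad(\vec e=(e_1,\ldots,e_m)\in\mathcal{E}(\vec e_0)),$$ where the implied constant depends only on $t$ and $m$.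
   Context: $|\vec e|=e_1+\cdots+e_m$. $\mathcal{E}(\vec e_0)=\{\vec e=(e_1,\ldots,e_m)\in\mathbb{Z}^m:\ 0\leqslant e_j\leqslant e_{0,j},\ 1\leqslant j\leqslant m\}$. For $\vec e\in\mathbb{Z}^m_{\geqslant0}$, $$f_{\vec e}(y_1,\ldots,y_m)=\frac{1}{\ell}\left(\prod_{i=1}^m(\ell y_i+r_i)^{e_i}-\prod_{i=1}^m r_i^{e_i}\right)$$ (so $f_{\vec 0}=0$). -}

module Defs where

open import Data.Nat as ℕ using (ℕ; zero; suc; _≤_; _∸_)
open import Data.Integer using (+_)
open import Data.Rational using (ℚ; 0ℚ; 1ℚ; _+_; _*_; _-_; _/_)
open import Data.Fin using (Fin)
import Data.Fin as Fin
open import Data.Vec.Functional using (_∷_)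

_^ℚ_ : ℚ → ℕ → ℚ
x ^ℚ zero  = 1ℚ
x ^ℚ suc n = x * (x ^ℚ n)

ι : ℕ → ℚ
ι n = (+ n) / 1

∣_∣ᵉ : ∀ {m} → (Fin m → ℕ) → ℕ
∣_∣ᵉ {zero}  e = 0
∣_∣ᵉ {suc m} e = e Fin.zero ℕ.+ ∣ (λ i → e (Fin.suc i)) ∣ᵉ

∏ : ∀ m → (Fin m → ℚ) → ℚ
∏ zero    g = 1ℚ
∏ (suc m) g = g Fin.zero * ∏ m (λ i → g (Fin.suc i))

Σ≤ : ℕ → (ℕ → ℚ) → ℚ
Σ≤ zero    g = g 0
Σ≤ (suc n) g = Σ≤ n g + g (suc n)

-- Σ_{e ∈ 𝓔(e₀)} g e, where 𝓔(e₀) = {e : 0 ≤ e_j ≤ e₀_j for all j}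
Σ𝓔 : ∀ m → (Fin m → ℕ) → ((Fin m → ℕ) → ℚ) → ℚ
Σ𝓔 zero    e₀ g = g (λ ())
Σ𝓔 (suc m) e₀ g =
  Σ≤ (e₀ Fin.zero) (λ k → Σ𝓔 m (λ i → e₀ (Fin.suc i)) (λ e → g (k ∷ e)))

_≤ᵉ_ : ∀ {m} → (Fin m → ℕ) → (Fin m → ℕ) → Set
e ≤ᵉ e₀ = ∀ i → e i ≤ e₀ i

f : ∀ m (ℓ : ℕ) → .{{ℕ.NonZero ℓ}} → (r : Fin m → ℕ) →
    (e : Fin m → ℕ) → (y : Fin m → ℚ) → ℚ
f m ℓ r e y =
  ((+ 1) / ℓ) * (∏ m (λ i → ((ι ℓ * y i) + ι (r i)) ^ℚ e i)
                - ∏ m (λ i → ι (r i) ^ℚ e i))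

{-# OPTIONS --safe #-}
-- Put a_i = ℓ y_i + r_i. The binomial theorem in each coordinate expands
-- ∏ (a_i - r_i)^{e₀_i} = ℓ^{|e₀|} y^{e₀} as Σ_{e ∈ 𝓔(e₀)} c_e a^e with
-- c_e = ∏ C(e₀_i, e_i) (-r_i)^{e₀_i - e_i}; the same expansion at a = r gives
-- Σ c_e r^e = 0 because |e₀| ≥ 1. Subtracting and dividing by ℓ expresses
-- ℓ^{|e₀|-1} y^{e₀} through the f_e, and C(n, k) ≤ 2^n bounds |c_e| by
-- 2^{|e₀|} r^{e₀ - e} for every e.
module Submission where

open import Defs
open import Data.Nat as ℕ using (ℕ; zero; suc; _≤_; _<_; _∸_; NonZero; z≤n)
import Data.Nat.Properties as ℕₚ
open import Data.Nat.Combinatorics using (_C_; nCn≡1; nCk+nC[k+1]≡[n+1]C[k+1])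
import Data.Nat.Coprimality as Coprimality
import Data.Integer as ℤ
import Data.Integer.Properties as ℤₚ
open import Data.Fin as Fin using (Fin; toℕ)
open import Data.Vec.Functional using (_∷_)
open import Data.Product using (Σ; _×_; _,_)
open import Function using (_∘_)
open import Data.Rational
  using (ℚ; 0ℚ; 1ℚ; _+_; _*_; _-_; -_; ∣_∣; mkℚ; _/_; *≤*; nonNegative)
  renaming (_≤_ to _≤ℚ_)
open import Data.Rational.Properties
open import Data.Rational.Solver using (module +-*-Solver)
open +-*-Solver using (solve; _:+_; _:*_; _:-_; _:=_; con)
open import Algebra.Bundles using (CommutativeSemiring; CommutativeRing)
import Algebra.Properties.CommutativeSemiring.Binomial as Binomial
import Algebra.Properties.CommutativeSemiring.Exp as Exp
import Algebra.Properties.Semiring.Sum as SemiringSum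
import Algebra.Properties.Semiring.Mult as SemiringMult
open import Relation.Binary.PropositionalEquality

-- Unlike ι n, this form of the embedding reduces under _+_, _*_ and _≤_.
private
  ι≡mkℚ : ∀ n → ι n ≡ mkℚ (ℤ.+ n) 0 (Coprimality.sym (Coprimality.1-coprimeTo n))
  ι≡mkℚ n = normalize-coprime _

ι-+ : ∀ a b → ι (a ℕ.+ b) ≡ ι a + ι b
ι-+ a b rewrite ι≡mkℚ a | ι≡mkℚ b =
  /-cong (sym (cong₂ ℤ._+_ (ℤₚ.*-identityʳ (ℤ.+ a)) (ℤₚ.*-identityʳ (ℤ.+ b)))) refl

ι-* : ∀ a b → ι (a ℕ.* b) ≡ ι a * ι b
ι-* a b rewrite ι≡mkℚ a | ι≡mkℚ b = /-cong (ℤₚ.pos-* a b) refl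

ι-^ : ∀ a n → ι (a ℕ.^ n) ≡ ι a ^ℚ n
ι-^ a zero    = refl
ι-^ a (suc n) = trans (ι-* a (a ℕ.^ n)) (cong (ι a *_) (ι-^ a n))

ι-mono-≤ : ∀ {a b} → a ≤ b → ι a ≤ℚ ι b
ι-mono-≤ {a} {b} a≤b rewrite ι≡mkℚ a | ι≡mkℚ b =
  *≤* (ℤₚ.*-monoʳ-≤-nonNeg (ℤ.+ 1) (ℤ.+≤+ a≤b))

0≤ι : ∀ n → 0ℚ ≤ℚ ι n
0≤ι n = ι-mono-≤ {0} {n} z≤n

∣ι∣ : ∀ n → ∣ ι n ∣ ≡ ι n
∣ι∣ n = 0≤p⇒∣p∣≡p (0≤ι n)

1/ℓ*ι[ℓ]≡1 : ∀ ℓ .{{_ : NonZero ℓ}} → (ℤ.+ 1 / ℓ) * ι ℓ ≡ 1ℚ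
1/ℓ*ι[ℓ]≡1 (suc n) =
  trans (cong₂ _*_ (normalize-coprime (Coprimality.1-coprimeTo (suc n))) (ι≡mkℚ (suc n)))
        (*-inverseˡ (mkℚ (ℤ.+ suc n) 0 (Coprimality.sym (Coprimality.1-coprimeTo (suc n)))))

ℚ-commutativeSemiring : CommutativeSemiring _ _
ℚ-commutativeSemiring = CommutativeRing.commutativeSemiring +-*-commutativeRing

open SemiringSum (CommutativeSemiring.semiring ℚ-commutativeSemiring) using (sum; sum-cong-≗)
open SemiringMult (CommutativeSemiring.semiring ℚ-commutativeSemiring)
  using () renaming (_×_ to _·_)
open Exp ℚ-commutativeSemiring using (_^_; ^-distrib-*; ^-homo-*)

^ℚ≡^ : ∀ x n → x ^ℚ n ≡ x ^ n
^ℚ≡^ x zero    = refl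
^ℚ≡^ x (suc n) = cong (x *_) (^ℚ≡^ x n)

^ℚ-+ : ∀ x m n → x ^ℚ (m ℕ.+ n) ≡ x ^ℚ m * x ^ℚ n
^ℚ-+ x m n rewrite ^ℚ≡^ x (m ℕ.+ n) | ^ℚ≡^ x m | ^ℚ≡^ x n = ^-homo-* x m n

^ℚ-distrib-* : ∀ x y n → (x * y) ^ℚ n ≡ x ^ℚ n * y ^ℚ n
^ℚ-distrib-* x y n rewrite ^ℚ≡^ (x * y) n | ^ℚ≡^ x n | ^ℚ≡^ y n = ^-distrib-* x y n

∣^ℚ∣ : ∀ x n → ∣ x ^ℚ n ∣ ≡ ∣ x ∣ ^ℚ n
∣^ℚ∣ x zero    = refl
∣^ℚ∣ x (suc n) = trans (∣p*q∣≡∣p∣*∣q∣ x (x ^ℚ n)) (cong (∣ x ∣ *_) (∣^ℚ∣ x n))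

·≡ι* : ∀ n x → n · x ≡ ι n * x
·≡ι* zero    x = sym (*-zeroˡ x)
·≡ι* (suc n) x = begin
  x + n · x          ≡⟨ cong (x +_) (·≡ι* n x) ⟩
  x + ι n * x        ≡⟨ solve 2 (λ x c → x :+ c :* x := (con 1ℚ :+ c) :* x) refl x (ι n) ⟩
  (1ℚ + ι n) * x     ≡⟨ cong (_* x) (sym (ι-+ 1 n)) ⟩
  ι (suc n) * x      ∎
  where open ≡-Reasoning

∏-cong : ∀ m {g h : Fin m → ℚ} → (∀ i → g i ≡ h i) → ∏ m g ≡ ∏ m h
∏-cong zero    g≗h = refl
∏-cong (suc m) g≗h = cong₂ _*_ (g≗h Fin.zero) (∏-cong m (g≗h ∘ Fin.suc))

∏-* : ∀ m (g h : Fin m → ℚ) → ∏ m (λ i → g i * h i) ≡ ∏ m g * ∏ m h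
∏-* zero    g h = refl
∏-* (suc m) g h = begin
  (g₀ * h₀) * ∏ m (λ i → g (Fin.suc i) * h (Fin.suc i))
    ≡⟨ cong ((g₀ * h₀) *_) (∏-* m (g ∘ Fin.suc) (h ∘ Fin.suc)) ⟩
  (g₀ * h₀) * (G * H)
    ≡⟨ solve 4 (λ a b c d → (a :* b) :* (c :* d) := (a :* c) :* (b :* d)) refl g₀ h₀ G H ⟩
  (g₀ * G) * (h₀ * H)
    ∎
  where
  open ≡-Reasoning
  g₀ = g Fin.zero
  h₀ = h Fin.zero
  G = ∏ m (g ∘ Fin.suc)
  H = ∏ m (h ∘ Fin.suc)

∏-1 : ∀ m → ∏ m (λ _ → 1ℚ) ≡ 1ℚ
∏-1 zero    = refl
∏-1 (suc m) = trans (*-identityˡ _) (∏-1 m)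

∏-^ : ∀ m u (e : Fin m → ℕ) → ∏ m (λ i → u ^ℚ e i) ≡ u ^ℚ ∣ e ∣ᵉ
∏-^ zero    u e = refl
∏-^ (suc m) u e =
  trans (cong (u ^ℚ e Fin.zero *_) (∏-^ m u (e ∘ Fin.suc))) (sym (^ℚ-+ u (e Fin.zero) _))

∏-scale : ∀ m u (y : Fin m → ℚ) (e : Fin m → ℕ) →
          ∏ m (λ i → (u * y i) ^ℚ e i) ≡ u ^ℚ ∣ e ∣ᵉ * ∏ m (λ i → y i ^ℚ e i)
∏-scale m u y e = begin
  ∏ m (λ i → (u * y i) ^ℚ e i)                  ≡⟨ ∏-cong m (λ i → ^ℚ-distrib-* u (y i) (e i)) ⟩
  ∏ m (λ i → u ^ℚ e i * y i ^ℚ e i)             ≡⟨ ∏-* m _ _ ⟩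
  ∏ m (λ i → u ^ℚ e i) * ∏ m (λ i → y i ^ℚ e i) ≡⟨ cong (_* _) (∏-^ m u e) ⟩
  u ^ℚ ∣ e ∣ᵉ * ∏ m (λ i → y i ^ℚ e i)          ∎
  where open ≡-Reasoning

∏-0^ : ∀ m (e : Fin m → ℕ) → 1 ≤ ∣ e ∣ᵉ → ∏ m (λ i → 0ℚ ^ℚ e i) ≡ 0ℚ
∏-0^ m e 1≤∣e∣ = trans (∏-^ m 0ℚ e) (0^ 1≤∣e∣)
  where
  0^ : ∀ {n} → 1 ≤ n → 0ℚ ^ℚ n ≡ 0ℚ
  0^ {suc n} _ = *-zeroˡ (0ℚ ^ℚ n)

∣∏∣ : ∀ m (g : Fin m → ℚ) → ∣ ∏ m g ∣ ≡ ∏ m (∣_∣ ∘ g)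
∣∏∣ zero    g = refl
∣∏∣ (suc m) g = trans (∣p*q∣≡∣p∣*∣q∣ (g Fin.zero) _) (cong (∣ g Fin.zero ∣ *_) (∣∏∣ m (g ∘ Fin.suc)))

∏-nonNeg : ∀ m {g : Fin m → ℚ} → (∀ i → 0ℚ ≤ℚ g i) → 0ℚ ≤ℚ ∏ m g
∏-nonNeg zero    0≤g = 0≤ι 1
∏-nonNeg (suc m) {g} 0≤g = nonNegative⁻¹ _
  {{nonNeg*nonNeg⇒nonNeg (g Fin.zero) {{nonNegative (0≤g Fin.zero)}}
                         (∏ m (g ∘ Fin.suc)) {{nonNegative (∏-nonNeg m (0≤g ∘ Fin.suc))}}}}

∏-mono-≤ : ∀ m {g h : Fin m → ℚ} → (∀ i → 0ℚ ≤ℚ g i) → (∀ i → g i ≤ℚ h i) → ∏ m g ≤ℚ ∏ m h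
∏-mono-≤ zero    0≤g g≤h = ≤-refl
∏-mono-≤ (suc m) {g} {h} 0≤g g≤h = ≤-trans
  (*-monoʳ-≤-nonNeg (∏ m (g ∘ Fin.suc)) {{nonNegative (∏-nonNeg m (0≤g ∘ Fin.suc))}} (g≤h Fin.zero))
  (*-monoˡ-≤-nonNeg (h Fin.zero) {{nonNegative (≤-trans (0≤g Fin.zero) (g≤h Fin.zero))}}
    (∏-mono-≤ m (0≤g ∘ Fin.suc) (g≤h ∘ Fin.suc)))

Σ≤-cong : ∀ n {g h : ℕ → ℚ} → (∀ k → g k ≡ h k) → Σ≤ n g ≡ Σ≤ n h
Σ≤-cong zero    g≗h = g≗h 0
Σ≤-cong (suc n) g≗h = cong₂ _+_ (Σ≤-cong n g≗h) (g≗h (suc n))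

Σ≤-*ˡ : ∀ n s (g : ℕ → ℚ) → Σ≤ n (λ k → s * g k) ≡ s * Σ≤ n g
Σ≤-*ˡ zero    s g = refl
Σ≤-*ˡ (suc n) s g =
  trans (cong (_+ s * g (suc n)) (Σ≤-*ˡ n s g)) (sym (*-distribˡ-+ s (Σ≤ n g) (g (suc n))))

Σ≤-*ʳ : ∀ n s (g : ℕ → ℚ) → Σ≤ n (λ k → g k * s) ≡ Σ≤ n g * s
Σ≤-*ʳ zero    s g = refl
Σ≤-*ʳ (suc n) s g =
  trans (cong (_+ g (suc n) * s) (Σ≤-*ʳ n s g)) (sym (*-distribʳ-+ s (Σ≤ n g) (g (suc n))))

Σ≤-- : ∀ n (g h : ℕ → ℚ) → Σ≤ n (λ k → g k - h k) ≡ Σ≤ n g - Σ≤ n h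
Σ≤-- zero    g h = refl
Σ≤-- (suc n) g h = trans (cong (_+ (g (suc n) - h (suc n))) (Σ≤-- n g h))
  (solve 4 (λ a b c d → (a :- b) :+ (c :- d) := (a :+ c) :- (b :+ d)) refl
     (Σ≤ n g) (Σ≤ n h) (g (suc n)) (h (suc n)))

Σ≤-suc : ∀ n (g : ℕ → ℚ) → Σ≤ (suc n) g ≡ g 0 + Σ≤ n (g ∘ suc)
Σ≤-suc zero    g = refl
Σ≤-suc (suc n) g = trans (cong (_+ g (suc (suc n))) (Σ≤-suc n g)) (+-assoc (g 0) _ _)

sum≡Σ≤ : ∀ n (g : ℕ → ℚ) → sum {suc n} (g ∘ toℕ) ≡ Σ≤ n g
sum≡Σ≤ zero    g = +-identityʳ (g 0)
sum≡Σ≤ (suc n) g = trans (cong (g 0 +_) (sum≡Σ≤ n (g ∘ suc))) (sym (Σ≤-suc n g))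

Σ𝓔-cong : ∀ m e₀ {g h : (Fin m → ℕ) → ℚ} → (∀ e → g e ≡ h e) → Σ𝓔 m e₀ g ≡ Σ𝓔 m e₀ h
Σ𝓔-cong zero    e₀ g≗h = g≗h _
Σ𝓔-cong (suc m) e₀ g≗h = Σ≤-cong (e₀ Fin.zero) (λ k → Σ𝓔-cong m (e₀ ∘ Fin.suc) (g≗h ∘ (k ∷_)))

Σ𝓔-*ˡ : ∀ m e₀ s (g : (Fin m → ℕ) → ℚ) → Σ𝓔 m e₀ (λ e → s * g e) ≡ s * Σ𝓔 m e₀ g
Σ𝓔-*ˡ zero    e₀ s g = refl
Σ𝓔-*ˡ (suc m) e₀ s g =
  trans (Σ≤-cong (e₀ Fin.zero) (λ k → Σ𝓔-*ˡ m (e₀ ∘ Fin.suc) s (g ∘ (k ∷_)))) (Σ≤-*ˡ (e₀ Fin.zero) s _)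

Σ𝓔-- : ∀ m e₀ (g h : (Fin m → ℕ) → ℚ) → Σ𝓔 m e₀ (λ e → g e - h e) ≡ Σ𝓔 m e₀ g - Σ𝓔 m e₀ h
Σ𝓔-- zero    e₀ g h = refl
Σ𝓔-- (suc m) e₀ g h =
  trans (Σ≤-cong (e₀ Fin.zero) (λ k → Σ𝓔-- m (e₀ ∘ Fin.suc) (g ∘ (k ∷_)) (h ∘ (k ∷_)))) (Σ≤-- (e₀ Fin.zero) _ _)

Σ𝓔-∏ : ∀ m e₀ (g : Fin m → ℕ → ℚ) →
       Σ𝓔 m e₀ (λ e → ∏ m (λ i → g i (e i))) ≡ ∏ m (λ i → Σ≤ (e₀ i) (g i))
Σ𝓔-∏ zero    e₀ g = refl
Σ𝓔-∏ (suc m) e₀ g = begin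
  Σ≤ (e₀ Fin.zero) (λ k → Σ𝓔 m (e₀ ∘ Fin.suc) (λ e → g Fin.zero k * ∏ m (λ i → g (Fin.suc i) (e i))))
    ≡⟨ Σ≤-cong (e₀ Fin.zero) (λ k → trans (Σ𝓔-*ˡ m (e₀ ∘ Fin.suc) (g Fin.zero k) _)
                                           (cong (g Fin.zero k *_) (Σ𝓔-∏ m (e₀ ∘ Fin.suc) (g ∘ Fin.suc)))) ⟩
  Σ≤ (e₀ Fin.zero) (λ k → g Fin.zero k * ∏ m (λ i → Σ≤ (e₀ (Fin.suc i)) (g (Fin.suc i))))
    ≡⟨ Σ≤-*ʳ (e₀ Fin.zero) _ (g Fin.zero) ⟩
  Σ≤ (e₀ Fin.zero) (g Fin.zero) * ∏ m (λ i → Σ≤ (e₀ (Fin.suc i)) (g (Fin.suc i)))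
    ∎
  where open ≡-Reasoning

binomialCoeff : ℕ → ℚ → ℕ → ℚ
binomialCoeff n b k = ι (n C k) * (- b) ^ℚ (n ∸ k)

binomial-expansion : ∀ n a b → (a - b) ^ℚ n ≡ Σ≤ n (λ k → binomialCoeff n b k * a ^ℚ k)
binomial-expansion n a b = begin
  (a - b) ^ℚ n
    ≡⟨ ^ℚ≡^ (a - b) n ⟩
  (a - b) ^ n
    ≡⟨ Binomial.theorem ℚ-commutativeSemiring n a (- b) ⟩
  sum {suc n} (λ k → (n C toℕ k) · (a ^ toℕ k * (- b) ^ (n ∸ toℕ k)))
    ≡⟨ sum-cong-≗ {suc n} (term ∘ toℕ) ⟩
  sum {suc n} (λ k → binomialCoeff n b (toℕ k) * a ^ℚ toℕ k)
    ≡⟨ sum≡Σ≤ n (λ k → binomialCoeff n b k * a ^ℚ k) ⟩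
  Σ≤ n (λ k → binomialCoeff n b k * a ^ℚ k)
    ∎
  where
  open ≡-Reasoning
  term : ∀ k → (n C k) · (a ^ k * (- b) ^ (n ∸ k)) ≡ binomialCoeff n b k * a ^ℚ k
  term k
    rewrite ·≡ι* (n C k) (a ^ k * (- b) ^ (n ∸ k)) | sym (^ℚ≡^ a k) | sym (^ℚ≡^ (- b) (n ∸ k)) =
    solve 3 (λ c x y → c :* (x :* y) := (c :* y) :* x) refl
      (ι (n C k)) (a ^ℚ k) ((- b) ^ℚ (n ∸ k))

binomialCoeff-diagonal : ∀ n b → binomialCoeff n b n ≡ 1ℚ
binomialCoeff-diagonal n b rewrite nCn≡1 n | ℕₚ.n∸n≡0 n = *-identityˡ 1ℚ

coeff : ∀ {m} → (Fin m → ℕ) → (Fin m → ℚ) → (Fin m → ℕ) → ℚ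
coeff {m} e₀ b e = ∏ m (λ i → binomialCoeff (e₀ i) (b i) (e i))

coeff-diagonal : ∀ {m} (e₀ : Fin m → ℕ) b → coeff e₀ b e₀ ≡ 1ℚ
coeff-diagonal {m} e₀ b = trans (∏-cong m (λ i → binomialCoeff-diagonal (e₀ i) (b i))) (∏-1 m)

multinomial-expansion : ∀ m e₀ (a b : Fin m → ℚ) →
  Σ𝓔 m e₀ (λ e → coeff e₀ b e * ∏ m (λ i → a i ^ℚ e i)) ≡ ∏ m (λ i → (a i - b i) ^ℚ e₀ i)
multinomial-expansion m e₀ a b = begin
  Σ𝓔 m e₀ (λ e → coeff e₀ b e * ∏ m (λ i → a i ^ℚ e i))
    ≡⟨ Σ𝓔-cong m e₀ (λ e → sym (∏-* m _ _)) ⟩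
  Σ𝓔 m e₀ (λ e → ∏ m (λ i → binomialCoeff (e₀ i) (b i) (e i) * a i ^ℚ e i))
    ≡⟨ Σ𝓔-∏ m e₀ (λ i k → binomialCoeff (e₀ i) (b i) k * a i ^ℚ k) ⟩
  ∏ m (λ i → Σ≤ (e₀ i) (λ k → binomialCoeff (e₀ i) (b i) k * a i ^ℚ k))
    ≡⟨ ∏-cong m (λ i → sym (binomial-expansion (e₀ i) (a i) (b i))) ⟩
  ∏ m (λ i → (a i - b i) ^ℚ e₀ i)
    ∎
  where open ≡-Reasoning

Σ𝓔-coeff*f : ∀ m ℓ .{{_ : NonZero ℓ}} (r e₀ : Fin m → ℕ) → 1 ≤ ∣ e₀ ∣ᵉ → ∀ y →
  Σ𝓔 m e₀ (λ e → coeff e₀ (ι ∘ r) e * f m ℓ r e y) ≡ ι ℓ ^ℚ (∣ e₀ ∣ᵉ ∸ 1) * ∏ m (λ i → y i ^ℚ e₀ i)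
Σ𝓔-coeff*f m ℓ r e₀ 1≤∣e₀∣ y = begin
  Σ𝓔 m e₀ (λ e → c e * f m ℓ r e y)
    ≡⟨ Σ𝓔-cong m e₀ (λ e → distribute (c e) (A e) (B e)) ⟩
  Σ𝓔 m e₀ (λ e → s * (c e * A e - c e * B e))
    ≡⟨ trans (Σ𝓔-*ˡ m e₀ s _) (cong (s *_) (Σ𝓔-- m e₀ _ _)) ⟩
  s * (Σ𝓔 m e₀ (λ e → c e * A e) - Σ𝓔 m e₀ (λ e → c e * B e))
    ≡⟨ cong₂ (λ p q → s * (p - q)) (multinomial-expansion m e₀ a b) (multinomial-expansion m e₀ b b) ⟩
  s * (∏ m (λ i → (a i - b i) ^ℚ e₀ i) - ∏ m (λ i → (b i - b i) ^ℚ e₀ i))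
    ≡⟨ cong₂ (λ p q → s * (p - q))
         (trans (∏-cong m (λ i → cong (_^ℚ e₀ i) (a-b i))) (∏-scale m (ι ℓ) y e₀))
         (trans (∏-cong m (λ i → cong (_^ℚ e₀ i) (+-inverseʳ (b i)))) (∏-0^ m e₀ 1≤∣e₀∣)) ⟩
  s * (ι ℓ ^ℚ ∣ e₀ ∣ᵉ * Y - 0ℚ)
    ≡⟨ cancel 1≤∣e₀∣ ⟩
  ι ℓ ^ℚ (∣ e₀ ∣ᵉ ∸ 1) * Y
    ∎
  where
  open ≡-Reasoning
  s = ℤ.+ 1 / ℓ
  a b : Fin m → ℚ
  a i = ι ℓ * y i + ι (r i)
  b = ι ∘ r
  c = coeff e₀ b
  A B : (Fin m → ℕ) → ℚ
  A e = ∏ m (λ i → a i ^ℚ e i)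
  B e = ∏ m (λ i → b i ^ℚ e i)
  Y = ∏ m (λ i → y i ^ℚ e₀ i)
  distribute : ∀ c x z → c * (s * (x - z)) ≡ s * (c * x - c * z)
  distribute c x z =
    solve 4 (λ c s x z → c :* (s :* (x :- z)) := s :* (c :* x :- c :* z)) refl c s x z
  a-b : ∀ i → a i - b i ≡ ι ℓ * y i
  a-b i = solve 2 (λ u v → u :+ v :- v := u) refl (ι ℓ * y i) (b i)
  cancel : ∀ {n} → 1 ≤ n → s * (ι ℓ ^ℚ n * Y - 0ℚ) ≡ ι ℓ ^ℚ (n ∸ 1) * Y
  cancel {suc n} _ = begin
    s * (ι ℓ * ι ℓ ^ℚ n * Y - 0ℚ)
      ≡⟨ solve 4 (λ s u v w → s :* (u :* v :* w :- con 0ℚ) := (s :* u) :* (v :* w)) refl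
           s (ι ℓ) (ι ℓ ^ℚ n) Y ⟩
    (s * ι ℓ) * (ι ℓ ^ℚ n * Y)  ≡⟨ cong (_* (ι ℓ ^ℚ n * Y)) (1/ℓ*ι[ℓ]≡1 ℓ) ⟩
    1ℚ * (ι ℓ ^ℚ n * Y)         ≡⟨ *-identityˡ _ ⟩
    ι ℓ ^ℚ n * Y                ∎

nCk≤2^n : ∀ n k → n C k ≤ 2 ℕ.^ n
nCk≤2^n n       zero    = ℕₚ.m^n>0 2 n
nCk≤2^n zero    (suc k) = z≤n
nCk≤2^n (suc n) (suc k)
  rewrite sym (nCk+nC[k+1]≡[n+1]C[k+1] n k) | ℕₚ.+-identityʳ (2 ℕ.^ n) =
  ℕₚ.+-mono-≤ (nCk≤2^n n k) (nCk≤2^n n (suc k))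

∣binomialCoeff∣≤ : ∀ n k r → ∣ binomialCoeff n (ι r) k ∣ ≤ℚ ι 2 ^ℚ n * ι r ^ℚ (n ∸ k)
∣binomialCoeff∣≤ n k r = begin
  ∣ ι (n C k) * x ∣                ≡⟨ ∣p*q∣≡∣p∣*∣q∣ (ι (n C k)) x ⟩
  ∣ ι (n C k) ∣ * ∣ x ∣            ≡⟨ cong (_* ∣ x ∣) (∣ι∣ (n C k)) ⟩
  ι (n C k) * ∣ x ∣                ≤⟨ *-monoʳ-≤-nonNeg ∣ x ∣ {{nonNegative (0≤∣p∣ x)}} (ι-mono-≤ (nCk≤2^n n k)) ⟩
  ι (2 ℕ.^ n) * ∣ x ∣              ≡⟨ cong₂ _*_ (ι-^ 2 n) (∣^ℚ∣ (- ι r) (n ∸ k)) ⟩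
  ι 2 ^ℚ n * ∣ - ι r ∣ ^ℚ (n ∸ k)  ≡⟨ cong (λ z → ι 2 ^ℚ n * z ^ℚ (n ∸ k)) (trans (∣-p∣≡∣p∣ (ι r)) (∣ι∣ r)) ⟩
  ι 2 ^ℚ n * ι r ^ℚ (n ∸ k)        ∎
  where
  open ≤-Reasoning
  x = (- ι r) ^ℚ (n ∸ k)

∣coeff∣≤ : ∀ m (e₀ e r : Fin m → ℕ) →
  ∣ coeff e₀ (ι ∘ r) e ∣ ≤ℚ ι 2 ^ℚ ∣ e₀ ∣ᵉ * ∏ m (λ i → ι (r i) ^ℚ (e₀ i ∸ e i))
∣coeff∣≤ m e₀ e r = begin
  ∣ coeff e₀ (ι ∘ r) e ∣
    ≡⟨ ∣∏∣ m _ ⟩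
  ∏ m (λ i → ∣ binomialCoeff (e₀ i) (ι (r i)) (e i) ∣)
    ≤⟨ ∏-mono-≤ m (λ _ → 0≤∣p∣ _) (λ i → ∣binomialCoeff∣≤ (e₀ i) (e i) (r i)) ⟩
  ∏ m (λ i → ι 2 ^ℚ e₀ i * ι (r i) ^ℚ (e₀ i ∸ e i))
    ≡⟨ ∏-* m _ _ ⟩
  ∏ m (λ i → ι 2 ^ℚ e₀ i) * ∏ m (λ i → ι (r i) ^ℚ (e₀ i ∸ e i))
    ≡⟨ cong (_* ∏ m (λ i → ι (r i) ^ℚ (e₀ i ∸ e i))) (∏-^ m (ι 2) e₀) ⟩
  ι 2 ^ℚ ∣ e₀ ∣ᵉ * ∏ m (λ i → ι (r i) ^ℚ (e₀ i ∸ e i))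
    ∎
  where open ≤-Reasoning

∣coeff∣≤2^t : ∀ m t (e₀ e r : Fin m → ℕ) → ∣ e₀ ∣ᵉ ≤ t →
  ∣ coeff e₀ (ι ∘ r) e ∣ ≤ℚ ι (2 ℕ.^ t) * ∏ m (λ i → ι (r i) ^ℚ (e₀ i ∸ e i))
∣coeff∣≤2^t m t e₀ e r ∣e₀∣≤t = begin
  ∣ coeff e₀ (ι ∘ r) e ∣      ≤⟨ ∣coeff∣≤ m e₀ e r ⟩
  ι 2 ^ℚ ∣ e₀ ∣ᵉ * P          ≡⟨ cong (_* P) (ι-^ 2 ∣ e₀ ∣ᵉ) ⟨
  ι (2 ℕ.^ ∣ e₀ ∣ᵉ) * P       ≤⟨ *-monoʳ-≤-nonNeg P {{nonNegative 0≤P}}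
                                    (ι-mono-≤ (ℕₚ.^-monoʳ-≤ 2 ∣e₀∣≤t)) ⟩
  ι (2 ℕ.^ t) * P             ∎
  where
  open ≤-Reasoning
  P = ∏ m (λ i → ι (r i) ^ℚ (e₀ i ∸ e i))
  0≤P : 0ℚ ≤ℚ P
  0≤P = ∏-nonNeg m (λ i → subst (0ℚ ≤ℚ_) (ι-^ (r i) (e₀ i ∸ e i)) (0≤ι (r i ℕ.^ (e₀ i ∸ e i))))

lemma4p5 : (m t : ℕ) → 1 ≤ m → 1 ≤ t →
    Σ ℕ λ C → ((ℓ : ℕ) → .{{_ : NonZero ℓ}} → 2 ≤ ℓ →
      (r : Fin m → ℕ) → (∀ i → 1 ≤ r i × r i < ℓ) →
      (e₀ : Fin m → ℕ) → 1 ≤ ∣ e₀ ∣ᵉ → ∣ e₀ ∣ᵉ ≤ t →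
      Σ ((Fin m → ℕ) → ℚ) λ c → (((y : Fin m → ℚ) →
                 (ι ℓ ^ℚ (∣ e₀ ∣ᵉ ∸ 1)) * ∏ m (λ i → y i ^ℚ e₀ i)
                   ≡ Σ𝓔 m e₀ (λ e → c e * f m ℓ r e y))
              × c e₀ ≡ 1ℚ
              × ((e : Fin m → ℕ) → e ≤ᵉ e₀ →
                   ∣ c e ∣ ≤ℚ ι C * ∏ m (λ i → ι (r i) ^ℚ (e₀ i ∸ e i)))))
lemma4p5 m t _ _ = 2 ℕ.^ t , λ ℓ _ r _ e₀ 1≤∣e₀∣ ∣e₀∣≤t →
  coeff e₀ (ι ∘ r) ,
  (λ y → sym (Σ𝓔-coeff*f m ℓ r e₀ 1≤∣e₀∣ y)) ,
  coeff-diagonal e₀ (ι ∘ r) ,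
  (λ e _ → ∣coeff∣≤2^t m t e₀ e r ∣e₀∣≤t)
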